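{- Let $h>0$ and $\alpha>0$ be integers and $\lambda\vdash h+\alpha$, and let $\varphi_{\lambda,h,\alpha}$ and $\phi_{\lambda,h,\alpha}$ be the maps defined below. (1) If $T\in\operatorname{SYT}_{h,\alpha}(\lambda)\setminus\operatorname{SYT}_{h,\alpha-1}(\lambda)$ and $q:=\max\{1\leq i\leq h: R_{T}(i+\alpha)\leq R_{T}(\alpha)\}$, then $\varphi_{\lambda,h,\alpha}(T)\in\operatorname{SYT}_{h,\alpha-1}(\lambda)\setminus\operatorname{SYT}_{h,\alpha}(\lambda)$ and \[\min\{0\leq i\leq h-1: R_{\varphi_{\lambda,h,\alpha}(T)}(h+\alpha)\leq R_{\varphi_{\lambda,h,\alpha}(T)}(i+\alpha)\}=q-1.\] (2) If $T\in\operatorname{SYT}_{h,\alpha-1}(\lambda)\setminus\operatorname{SYT}_{h,\alpha}(\lambda)$ and $p:=\min\{0\leq i\leq h-1: R_{T}(h+\alpha)\leq R_{T}(i+\alpha)\}$, then $\phi_{\lambda,h,\alpha}(T)\in\operatorname{SYT}_{h,\alpha}(\lambda)\setminus\operatorname{SYT}_{h,\alpha-1}(\lambda)$ and \[\max\{1\leq i\leq h: R_{\phi_{\lambda,h,\alpha}(T)}(i+\alpha)\leq R_{\phi_{\lambda,h,\alpha}(T)}(\alpha)\}=p+1.\]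
   Context: For a partition $\lambda\vdash k$, its diagram has boxes $(i,j)$, $1\le i\le\ell(\lambda)$, $1\le j\le\lambda_i$ (row $i$ from the top). $\operatorname{SYT}(\lambda)$ is the set of standard Young tableaux of shape $\lambda$ (bijective fillings with $1,\ldots,k$ increasing along rows and down columns). For a tableau $T$, $R_T(m)$, $C_T(m)$ are the row and column of the box containing $m$, and $v_T(m)=(R_T(m),C_T(m))$. For $0\le h\le k$, $0\le\alpha\le k-h$, $\operatorname{SYT}_{h,\alpha}(\lambda)$ is the set of $T\in\operatorname{SYT}(\lambda)$ with $R_T(i+1+\alpha)>R_T(i+\alpha)$ for all $1\le i<h$. With $\lambda\vdash h+\alpha$: the map $\varphi_{\lambda,h,\alpha}$ on $\operatorname{SYT}_{h,\alpha}(\lambda)$ is the identity on $\operatorname{SYT}_{h,\alpha-1}(\lambda)$, and for other $T$, with $q$ as in (1), $\varphi_{\lambda,h,\alpha}(T)$ places $m$ in $v_T(m)$ if $1\le m\le\alpha-1$, in $v_T(m+1)$ if $\alpha\le m\le q-2+\alpha$ or $q+\alpha\le m\le h-1+\alpha$, in $v_T(\alpha)$ if $m=q-1+\alpha$, and in $v_T(q+\alpha)$ if $m=h+\alpha$. The map $\phi_{\lambda,h,\alpha}$ on $\operatorname{SYT}_{h,\alpha-1}(\lambda)$ is the identity on $\operatorname{SYT}_{h,\alpha}(\lambda)$, and for other $T$, with $p$ as in (2), $\phi_{\lambda,h,\alpha}(T)$ places $m$ in $v_T(m)$ if $1\le m\le\alpha-1$, in $v_T(m-1)$ if $1+\alpha\le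 m\le p+\alpha$ or $p+2+\alpha\le m\le h+\alpha$, in $v_T(h+\alpha)$ if $m=p+1+\alpha$, and in $v_T(p+\alpha)$ if $m=\alpha$. It is known that $\varphi_{\lambda,h,\alpha}$ maps $\operatorname{SYT}_{h,\alpha}(\lambda)$ into $\operatorname{SYT}_{h,\alpha-1}(\lambda)$ and $\phi_{\lambda,h,\alpha}$ maps $\operatorname{SYT}_{h,\alpha-1}(\lambda)$ into $\operatorname{SYT}_{h,\alpha}(\lambda)$. -}

module Defs where

open import Data.Nat using (ℕ; zero; suc; _+_; _∸_; _≤_; _<_; _≥_; _<ᵇ_; _≤ᵇ_; _≡ᵇ_)
open import Data.Bool using (Bool; true; false; if_then_else_; _∧_)
open import Data.List using (List; []; _∷_; map; upTo)
open import Data.Nat.ListAction using (sum)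
open import Data.Bool.ListAction using (all)
open import Data.List.Relation.Unary.All using (All)
open import Data.List.Relation.Unary.Linked using (Linked)
open import Data.Product using (_×_; _,_; proj₁; proj₂; ∃-syntax)
open import Relation.Binary.PropositionalEquality using (_≡_)
open import Relation.Nullary using (¬_)

IsPartitionOf : List ℕ → ℕ → Set
IsPartitionOf la k = Linked _≥_ la × All (0 <_) la × sum la ≡ k

-- length of row i (rows numbered from 1); 0 outside the partition
rowLen : List ℕ → ℕ → ℕ
rowLen la zero = 0
rowLen [] (suc i) = 0
rowLen (x ∷ xs) (suc zero) = x
rowLen (x ∷ xs) (suc (suc i)) = rowLen xs (suc i)

Box : Set
Box = ℕ × ℕ   -- (row , column), both starting at 1

InDiagram : List ℕ → Box → Set
InDiagram la (i , j) = 1 ≤ i × 1 ≤ j × j ≤ rowLen la i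

-- A tableau is recorded by the position v_T(m) of each entry m (only m ∈ [1,k] matter).
Tableau : Set
Tableau = ℕ → Box

R : Tableau → ℕ → ℕ
R T m = proj₁ (T m)

C : Tableau → ℕ → ℕ
C T m = proj₂ (T m)

record IsSYT (la : List ℕ) (k : ℕ) (T : Tableau) : Set where
  field
    inDiagram : ∀ m → 1 ≤ m → m ≤ k → InDiagram la (T m)
    injective : ∀ m m' → 1 ≤ m → m ≤ k → 1 ≤ m' → m' ≤ k → T m ≡ T m' → m ≡ m'
    surjective : ∀ b → InDiagram la b → ∃[ m ] (1 ≤ m × m ≤ k × T m ≡ b)
    rowIncr : ∀ m m' → 1 ≤ m → m ≤ k → 1 ≤ m' → m' ≤ k →
              R T m' ≡ R T m → C T m' ≡ suc (C T m) → m < m'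
    colIncr : ∀ m m' → 1 ≤ m → m ≤ k → 1 ≤ m' → m' ≤ k →
              C T m' ≡ C T m → R T m' ≡ suc (R T m) → m < m'

RowCond : ℕ → ℕ → Tableau → Set
RowCond h α T = ∀ i → 1 ≤ i → i < h → R T (i + α) < R T (suc i + α)

SYTh : List ℕ → ℕ → ℕ → ℕ → Tableau → Set
SYTh la k h α T = IsSYT la k T × RowCond h α T

IsMaxOf : (ℕ → Set) → ℕ → ℕ → ℕ → Set
IsMaxOf P lo hi q = lo ≤ q × q ≤ hi × P q × (∀ i → q < i → i ≤ hi → ¬ P i)

IsMinOf : (ℕ → Set) → ℕ → ℕ → ℕ → Set
IsMinOf P lo hi p = lo ≤ p × p ≤ hi × P p × (∀ i → lo ≤ i → i < p → ¬ P i)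

rowCondᵇ : ℕ → ℕ → Tableau → Bool
rowCondᵇ h α T = all (λ i → R T (i + α) <ᵇ R T (suc i + α)) (map suc (upTo (h ∸ 1)))

-- largest i ∈ [1,n] with P i (0 if none)
maxSat : (ℕ → Bool) → ℕ → ℕ
maxSat P zero = 0
maxSat P (suc n) = if P (suc n) then suc n else maxSat P n

-- smallest i ∈ [s, s+n-1] with P i (s+n if none)
minSatFrom : (ℕ → Bool) → ℕ → ℕ → ℕ
minSatFrom P s zero = s
minSatFrom P s (suc n) = if P s then s else minSatFrom P (suc s) n

qOf : ℕ → ℕ → Tableau → ℕ
qOf h α T = maxSat (λ i → R T (i + α) ≤ᵇ R T α) h

pOf : ℕ → ℕ → Tableau → ℕ
pOf h α T = minSatFrom (λ i → R T (h + α) ≤ᵇ R T (i + α)) 0 h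

varphiCore : ℕ → ℕ → ℕ → Tableau → Tableau
varphiCore h α q T m =
  if m <ᵇ α then T m
  else if m ≡ᵇ (q ∸ 1 + α) then T α
  else if m ≡ᵇ (h + α) then T (q + α)
  else if m <ᵇ (h + α) then T (suc m)
  else T m

phiCore : ℕ → ℕ → ℕ → Tableau → Tableau
phiCore h α p T m =
  if m <ᵇ α then T m
  else if m ≡ᵇ α then T (p + α)
  else if m ≡ᵇ suc (p + α) then T (h + α)
  else if m ≤ᵇ (h + α) then T (m ∸ 1)
  else T m

varphi : List ℕ → ℕ → ℕ → Tableau → Tableau
varphi la h α T = if rowCondᵇ h (α ∸ 1) T then T else varphiCore h α (qOf h α T) T

phi : List ℕ → ℕ → ℕ → Tableau → Tableau
phi la h α T = if rowCondᵇ h α T then T else phiCore h α (pOf h α T) T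

-- Both maps fix the entries below α and cyclically move the entries α, …, h+α, so the image
-- of T is T ∘ σ for an explicit permutation σ of 1, …, h+α (varphiIndex, with inverse phiIndex).
-- Reindexing a standard tableau keeps it standard as long as no two entries in horizontally or
-- vertically adjacent boxes change their order.  The row condition makes the rows of the moved
-- entries strictly increase, which rules out adjacency for every inverted pair except in one
-- configuration per map; there the box directly below α (for varphi), resp. directly above h+α (for phi,
-- using that row lengths decrease), holds an entry that fits nowhere in the chain.  The row
-- conditions of the image and its extremal index q-1, resp. p+1, are then read off from σ.

module Submission where

open import Defs
open import Data.Nat using (ℕ; zero; suc; _+_; _∸_; _≤_; _<_; _≥_; z≤n; s≤s; _<ᵇ_; _≤ᵇ_; _≡ᵇ_)
open import Data.Nat.Properties
open import Data.Bool using (Bool; true; false; if_then_else_; T)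
open import Data.Bool.Properties using (T-≡)
open import Data.List using (List; []; _∷_)
open import Data.List.Relation.Unary.All as All using ()
open import Data.List.Relation.Unary.All.Properties using (all⁺)
open import Data.List.Relation.Unary.Linked using (Linked; _∷_)
open import Data.List.Membership.Propositional.Properties using (∈-map⁺; ∈-upTo⁺)
open import Data.Sum using (_⊎_; inj₁; inj₂)
open import Data.Product using (_×_; _,_; proj₁; proj₂; ∃-syntax)
open import Function using (_∘_; Equivalence)
open import Relation.Binary.PropositionalEquality
open import Relation.Binary.Definitions using (tri<; tri≈; tri>)
open import Relation.Nullary using (¬_; yes; no; contradiction)

private variable
  m n : ℕ
  b : Bool

T⇒≡true : T b → b ≡ true
T⇒≡true = Equivalence.to T-≡

¬T⇒≡false : ¬ T b → b ≡ false
¬T⇒≡false {false} _ = refl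
¬T⇒≡false {true} ¬b = contradiction _ ¬b

<ᵇ-true : m < n → (m <ᵇ n) ≡ true
<ᵇ-true = T⇒≡true ∘ <⇒<ᵇ

<ᵇ-false : ¬ m < n → (m <ᵇ n) ≡ false
<ᵇ-false m≮n = ¬T⇒≡false (m≮n ∘ <ᵇ⇒< _ _)

≤ᵇ-true : m ≤ n → (m ≤ᵇ n) ≡ true
≤ᵇ-true = T⇒≡true ∘ ≤⇒≤ᵇ

≤ᵇ-false : ¬ m ≤ n → (m ≤ᵇ n) ≡ false
≤ᵇ-false m≰n = ¬T⇒≡false (m≰n ∘ ≤ᵇ⇒≤ _ _)

≡ᵇ-true : m ≡ n → (m ≡ᵇ n) ≡ true
≡ᵇ-true = T⇒≡true ∘ ≡⇒≡ᵇ _ _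

≡ᵇ-false : m ≢ n → (m ≡ᵇ n) ≡ false
≡ᵇ-false m≢n = ¬T⇒≡false (m≢n ∘ ≡ᵇ⇒≡ _ _)

rowCondᵇ-sound : ∀ h β t → T (rowCondᵇ h β t) → RowCond h β t
rowCondᵇ-sound h β t holds (suc j) _ 1+j<h =
  <ᵇ⇒< _ _ (All.lookup (all⁺ _ _ holds) (∈-map⁺ suc (∈-upTo⁺ (∸-monoˡ-< 1+j<h (s≤s z≤n)))))

maxSat-unique : (P : ℕ → Bool) → ∀ n {q} → IsMaxOf (T ∘ P) 1 n q → maxSat P n ≡ q
maxSat-unique P zero (1≤q , q≤0 , _) = contradiction (≤-trans 1≤q q≤0) λ ()
maxSat-unique P (suc n) (1≤q , q≤1+n , Pq , above) with m≤n⇒m<n∨m≡n q≤1+n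
... | inj₂ refl rewrite T⇒≡true Pq = refl
... | inj₁ q<1+n rewrite ¬T⇒≡false (above (suc n) q<1+n ≤-refl) =
  maxSat-unique P n (1≤q , ≤-pred q<1+n , Pq , λ i q<i i≤n → above i q<i (m≤n⇒m≤1+n i≤n))

minSatFrom-unique : (P : ℕ → Bool) → ∀ n {s p} → s ≤ p → p < s + n → T (P p) →
  (∀ i → s ≤ i → i < p → ¬ T (P i)) → minSatFrom P s n ≡ p
minSatFrom-unique P zero {s} s≤p p<s+0 _ _ = contradiction (subst (_ <_) (+-identityʳ s) p<s+0) (≤⇒≯ s≤p)
minSatFrom-unique P (suc n) {s} {p} s≤p p<s+1+n Pp below with m≤n⇒m<n∨m≡n s≤p
... | inj₂ refl rewrite T⇒≡true Pp = refl
... | inj₁ s<p rewrite ¬T⇒≡false (below s ≤-refl s<p) =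
  minSatFrom-unique P n s<p (subst (p <_) (+-suc s n) p<s+1+n) Pp (λ i s<i → below i (<⇒≤ s<i))

RowCond-step : ∀ {h β n} t → RowCond h β t → β < n → suc n ≤ h + β → R t n < R t (suc n)
RowCond-step {h} {β} {n} t rc β<n n<h+β =
  subst (λ z → R t z < R t (suc z)) (m∸n+n≡m (<⇒≤ β<n))
    (rc (n ∸ β) (m<n⇒0<n∸m β<n) (subst (n ∸ β <_) (m+n∸n≡m h β) (∸-monoˡ-< n<h+β (<⇒≤ β<n))))

RowCond⇒R-increasing : ∀ {h β x y} t → RowCond h β t → β < x → x < y → y ≤ h + β → R t x < R t y
RowCond⇒R-increasing t rc β<x (s≤s x≤y) 1+y≤h+β with m≤n⇒m<n∨m≡n x≤y
... | inj₂ refl = RowCond-step t rc β<x 1+y≤h+β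
... | inj₁ x<y = <-trans (RowCond⇒R-increasing t rc β<x x<y (<⇒≤ 1+y≤h+β))
                          (RowCond-step t rc (<-trans β<x x<y) 1+y≤h+β)

¬RowCond⇒2≤h : ∀ {h β} t → ¬ RowCond h β t → 2 ≤ h
¬RowCond⇒2≤h {zero} _ ¬rc = contradiction (λ _ _ ()) ¬rc
¬RowCond⇒2≤h {suc zero} _ ¬rc = contradiction (λ { _ 1≤i (s≤s i≤0) → contradiction (≤-trans 1≤i i≤0) λ () }) ¬rc
¬RowCond⇒2≤h {suc (suc h)} _ _ = s≤s (s≤s z≤n)

varphiIndex : ℕ → ℕ → ℕ → ℕ → ℕ
varphiIndex A P H m =
  if m <ᵇ A then m
  else if m ≡ᵇ P then A
  else if m ≡ᵇ H then suc P
  else if m <ᵇ H then suc m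
  else m

phiIndex : ℕ → ℕ → ℕ → ℕ → ℕ
phiIndex A P H m =
  if m <ᵇ A then m
  else if m ≡ᵇ A then P
  else if m ≡ᵇ suc P then H
  else if m ≤ᵇ H then m ∸ 1
  else m

varphiCore≡varphiIndex : ∀ h α p t m → varphiCore h α (suc p) t m ≡ t (varphiIndex α (p + α) (h + α) m)
varphiCore≡varphiIndex h α p t m with m <ᵇ α
... | true = refl
... | false with m ≡ᵇ (p + α)
...   | true = refl
...   | false with m ≡ᵇ (h + α)
...     | true = refl
...     | false with m <ᵇ (h + α)
...       | true = refl
...       | false = refl

phiCore≡phiIndex : ∀ h α p t m → phiCore h α p t m ≡ t (phiIndex α (p + α) (h + α) m)
phiCore≡phiIndex h α p t m with m <ᵇ α
... | true = refl
... | false with m ≡ᵇ α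
...   | true = refl
...   | false with m ≡ᵇ suc (p + α)
...     | true = refl
...     | false with m ≤ᵇ (h + α)
...       | true = refl
...       | false = refl

module IndexCycle {A P H : ℕ} (A≤P : A ≤ P) (P<H : P < H) where

  σ τ : ℕ → ℕ
  σ = varphiIndex A P H
  τ = phiIndex A P H

  A<H : A < H
  A<H = ≤-<-trans A≤P P<H

  data σ-Case (m : ℕ) : Set where
    below : m < A → σ-Case m
    at-P : m ≡ P → σ-Case m
    at-H : m ≡ H → σ-Case m
    between : A ≤ m → m < H → m ≢ P → σ-Case m
    above : H < m → σ-Case m

  σ-case : ∀ m → σ-Case m
  σ-case m with m <? A | m ≟ P | <-cmp m H
  ... | yes m<A | _ | _ = below m<A
  ... | no _ | yes m≡P | _ = at-P m≡P
  ... | no m≮A | no m≢P | tri< m<H _ _ = between (≮⇒≥ m≮A) m<H m≢P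
  ... | no _ | no _ | tri≈ _ m≡H _ = at-H m≡H
  ... | no _ | no _ | tri> _ _ H<m = above H<m

  data τ-Case (m : ℕ) : Set where
    below : m < A → τ-Case m
    at-A : m ≡ A → τ-Case m
    at-1+P : m ≡ suc P → τ-Case m
    between : A < m → m ≤ H → m ≢ suc P → τ-Case m
    above : H < m → τ-Case m

  τ-case : ∀ m → τ-Case m
  τ-case m with <-cmp m A | m ≟ suc P | m ≤? H
  ... | tri< m<A _ _ | _ | _ = below m<A
  ... | tri≈ _ m≡A _ | _ | _ = at-A m≡A
  ... | tri> _ _ _ | yes m≡1+P | _ = at-1+P m≡1+P
  ... | tri> _ _ A<m | no m≢1+P | yes m≤H = between A<m m≤H m≢1+P
  ... | tri> _ _ _ | no _ | no m≰H = above (≰⇒> m≰H)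

  σ-below : m < A → σ m ≡ m
  σ-below m<A rewrite <ᵇ-true m<A = refl

  σ-P : σ P ≡ A
  σ-P rewrite <ᵇ-false (≤⇒≯ A≤P) | ≡ᵇ-true (refl {x = P}) = refl

  σ-H : σ H ≡ suc P
  σ-H rewrite <ᵇ-false (≤⇒≯ (<⇒≤ A<H)) | ≡ᵇ-false (≢-sym (<⇒≢ P<H)) | ≡ᵇ-true (refl {x = H}) = refl

  σ-between : A ≤ m → m < H → m ≢ P → σ m ≡ suc m
  σ-between A≤m m<H m≢P rewrite <ᵇ-false (≤⇒≯ A≤m) | ≡ᵇ-false m≢P | ≡ᵇ-false (<⇒≢ m<H) | <ᵇ-true m<H = refl

  σ-above : H < m → σ m ≡ m
  σ-above H<m rewrite <ᵇ-false (≤⇒≯ (<⇒≤ (<-trans A<H H<m))) | ≡ᵇ-false (≢-sym (<⇒≢ (<-trans P<H H<m)))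
    | ≡ᵇ-false (≢-sym (<⇒≢ H<m)) | <ᵇ-false (<-asym H<m) = refl

  τ-below : m < A → τ m ≡ m
  τ-below m<A rewrite <ᵇ-true m<A = refl

  τ-A : τ A ≡ P
  τ-A rewrite <ᵇ-false (<-irrefl (refl {x = A})) | ≡ᵇ-true (refl {x = A}) = refl

  τ-1+P : τ (suc P) ≡ H
  τ-1+P rewrite <ᵇ-false (≤⇒≯ (m≤n⇒m≤1+n A≤P)) | ≡ᵇ-false (≢-sym (<⇒≢ (s≤s A≤P))) | ≡ᵇ-true (refl {x = suc P}) = refl

  τ-between : A < m → m ≤ H → m ≢ suc P → τ m ≡ m ∸ 1
  τ-between A<m m≤H m≢1+P rewrite <ᵇ-false (≤⇒≯ (<⇒≤ A<m)) | ≡ᵇ-false (≢-sym (<⇒≢ A<m)) | ≡ᵇ-false m≢1+P | ≤ᵇ-true m≤H = refl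

  τ-above : H < m → τ m ≡ m
  τ-above H<m rewrite <ᵇ-false (≤⇒≯ (<⇒≤ (<-trans A<H H<m))) | ≡ᵇ-false (≢-sym (<⇒≢ (<-trans A<H H<m)))
    | ≡ᵇ-false (≢-sym (<⇒≢ (<-≤-trans (s≤s P<H) H<m))) | ≤ᵇ-false (<⇒≱ H<m) = refl

  τ∘σ≡id : ∀ m → τ (σ m) ≡ m
  τ∘σ≡id m with σ-case m
  ... | below m<A rewrite σ-below m<A = τ-below m<A
  ... | at-P refl rewrite σ-P = τ-A
  ... | at-H refl rewrite σ-H = τ-1+P
  ... | between A≤m m<H m≢P rewrite σ-between A≤m m<H m≢P = τ-between (s≤s A≤m) m<H (m≢P ∘ suc-injective)
  ... | above H<m rewrite σ-above H<m = τ-above H<m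

  σ∘τ≡id : ∀ m → σ (τ m) ≡ m
  σ∘τ≡id m with τ-case m
  ... | below m<A rewrite τ-below m<A = σ-below m<A
  ... | at-A refl rewrite τ-A = σ-P
  ... | at-1+P refl rewrite τ-1+P = σ-H
  ... | above H<m rewrite τ-above H<m = σ-above H<m
  σ∘τ≡id (suc m) | between A<1+m 1+m≤H 1+m≢1+P rewrite τ-between A<1+m 1+m≤H 1+m≢1+P =
    σ-between (≤-pred A<1+m) 1+m≤H (1+m≢1+P ∘ cong suc)

  σ-range : 1 ≤ A → 1 ≤ m → m ≤ H → 1 ≤ σ m × σ m ≤ H
  σ-range {m} 1≤A 1≤m m≤H with σ-case m
  ... | below m<A rewrite σ-below m<A = 1≤m , m≤H
  ... | at-P refl rewrite σ-P = 1≤A , <⇒≤ A<H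
  ... | at-H refl rewrite σ-H = s≤s z≤n , P<H
  ... | between A≤m m<H m≢P rewrite σ-between A≤m m<H m≢P = s≤s z≤n , m<H
  ... | above H<m = contradiction m≤H (<⇒≱ H<m)

  τ-range : 1 ≤ A → 1 ≤ m → m ≤ H → 1 ≤ τ m × τ m ≤ H
  τ-range {m} 1≤A 1≤m m≤H with τ-case m
  ... | below m<A rewrite τ-below m<A = 1≤m , m≤H
  ... | at-A refl rewrite τ-A = ≤-trans 1≤A A≤P , <⇒≤ P<H
  ... | at-1+P refl rewrite τ-1+P = ≤-trans 1≤A (<⇒≤ A<H) , ≤-refl
  ... | above H<m = contradiction m≤H (<⇒≱ H<m)
  τ-range {suc m} 1≤A _ 1+m≤H | between A<1+m _ 1+m≢1+P rewrite τ-between A<1+m 1+m≤H 1+m≢1+P =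
    ≤-trans 1≤A (≤-pred A<1+m) , ≤-trans (n≤1+n m) 1+m≤H

  A≤σ : A ≤ m → A ≤ σ m
  A≤σ {m} A≤m with σ-case m
  ... | below m<A = contradiction A≤m (<⇒≱ m<A)
  ... | at-P refl rewrite σ-P = ≤-refl
  ... | at-H refl rewrite σ-H = m≤n⇒m≤1+n A≤P
  ... | between A≤m m<H m≢P rewrite σ-between A≤m m<H m≢P = m≤n⇒m≤1+n A≤m
  ... | above H<m rewrite σ-above H<m = A≤m

  A≤τ : A ≤ m → A ≤ τ m
  A≤τ {m} A≤m with τ-case m
  ... | below m<A = contradiction A≤m (<⇒≱ m<A)
  ... | at-A refl rewrite τ-A = A≤P
  ... | at-1+P refl rewrite τ-1+P = <⇒≤ A<H
  ... | above H<m rewrite τ-above H<m = A≤m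
  A≤τ {suc m} _ | between A<1+m 1+m≤H 1+m≢1+P rewrite τ-between A<1+m 1+m≤H 1+m≢1+P = ≤-pred A<1+m

rowLen-antitone : ∀ {la} → Linked _≥_ la → ∀ {r} → 1 ≤ r → rowLen la (suc r) ≤ rowLen la r
rowLen-antitone {[]} _ _ = z≤n
rowLen-antitone {_ ∷ []} _ {suc zero} _ = z≤n
rowLen-antitone {_ ∷ []} _ {suc (suc _)} _ = z≤n
rowLen-antitone {_ ∷ _ ∷ _} (x≥y ∷ _) {suc zero} _ = x≥y
rowLen-antitone {_ ∷ _ ∷ _} (_ ∷ linked) {suc (suc r)} _ = rowLen-antitone linked {suc r} (s≤s z≤n)

Adjacent : Tableau → ℕ → ℕ → Set
Adjacent t a b = (R t b ≡ R t a × C t b ≡ suc (C t a)) ⊎ (C t b ≡ C t a × R t b ≡ suc (R t a))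

module Standard {la : List ℕ} {k : ℕ} {t : Tableau} (syt : IsSYT la k t) where
  open IsSYT syt

  IsSYT-reindex : (σ τ : ℕ → ℕ) →
    (∀ m → 1 ≤ m → m ≤ k → 1 ≤ σ m × σ m ≤ k) →
    (∀ m → 1 ≤ m → m ≤ k → 1 ≤ τ m × τ m ≤ k) →
    (∀ m → τ (σ m) ≡ m) → (∀ m → σ (τ m) ≡ m) →
    (∀ a b → 1 ≤ a → a ≤ k → 1 ≤ b → b ≤ k → a < b → τ b < τ a → ¬ Adjacent t a b) →
    (U : Tableau) → (∀ m → U m ≡ t (σ m)) → IsSYT la k U
  IsSYT-reindex σ τ σ-range τ-range τ∘σ σ∘τ noInversion U U≡tσ = record
    { inDiagram = λ m 1≤m m≤k →
        subst (InDiagram la) (sym (U≡tσ m)) (inDiagram (σ m) (proj₁ (σ-range m 1≤m m≤k)) (proj₂ (σ-range m 1≤m m≤k)))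
    ; injective = λ m m' 1≤m m≤k 1≤m' m'≤k Um≡Um' → begin
        m            ≡⟨ sym (τ∘σ m) ⟩
        τ (σ m)      ≡⟨ cong τ (injective (σ m) (σ m') (proj₁ (σ-range m 1≤m m≤k)) (proj₂ (σ-range m 1≤m m≤k))
                          (proj₁ (σ-range m' 1≤m' m'≤k)) (proj₂ (σ-range m' 1≤m' m'≤k))
                          (trans (sym (U≡tσ m)) (trans Um≡Um' (U≡tσ m')))) ⟩
        τ (σ m')     ≡⟨ τ∘σ m' ⟩
        m'           ∎
    ; surjective = λ box inDiag → let m , 1≤m , m≤k , tm≡box = surjective box inDiag in
        τ m , proj₁ (τ-range m 1≤m m≤k) , proj₂ (τ-range m 1≤m m≤k) ,
        trans (U≡tσ (τ m)) (trans (cong t (σ∘τ m)) tm≡box)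
    ; rowIncr = λ m m' 1≤m m≤k 1≤m' m'≤k sameRow nextCol →
        let R-eq = trans (sym (R-U m')) (trans sameRow (R-U m))
            C-eq = trans (sym (C-U m')) (trans nextCol (cong suc (C-U m)))
            σm-range = σ-range m 1≤m m≤k ; σm'-range = σ-range m' 1≤m' m'≤k
        in orderKept 1≤m m≤k 1≤m' m'≤k
             (rowIncr (σ m) (σ m') (proj₁ σm-range) (proj₂ σm-range) (proj₁ σm'-range) (proj₂ σm'-range) R-eq C-eq)
             (inj₁ (R-eq , C-eq))
    ; colIncr = λ m m' 1≤m m≤k 1≤m' m'≤k sameCol nextRow →
        let C-eq = trans (sym (C-U m')) (trans sameCol (C-U m))
            R-eq = trans (sym (R-U m')) (trans nextRow (cong suc (R-U m)))
            σm-range = σ-range m 1≤m m≤k ; σm'-range = σ-range m' 1≤m' m'≤k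
        in orderKept 1≤m m≤k 1≤m' m'≤k
             (colIncr (σ m) (σ m') (proj₁ σm-range) (proj₂ σm-range) (proj₁ σm'-range) (proj₂ σm'-range) C-eq R-eq)
             (inj₂ (C-eq , R-eq))
    }
    where
    open ≡-Reasoning

    R-U : ∀ m → R U m ≡ R t (σ m)
    R-U m = cong proj₁ (U≡tσ m)

    C-U : ∀ m → C U m ≡ C t (σ m)
    C-U m = cong proj₂ (U≡tσ m)

    orderKept : ∀ {m m'} → 1 ≤ m → m ≤ k → 1 ≤ m' → m' ≤ k → σ m < σ m' → Adjacent t (σ m) (σ m') → m < m'
    orderKept {m} {m'} 1≤m m≤k 1≤m' m'≤k σm<σm' adj with <-cmp m m'
    ... | tri< m<m' _ _ = m<m'
    ... | tri≈ _ refl _ = contradiction σm<σm' (<-irrefl refl)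
    ... | tri> _ _ m'<m = contradiction adj
          (noInversion (σ m) (σ m') (proj₁ (σ-range m 1≤m m≤k)) (proj₂ (σ-range m 1≤m m≤k))
            (proj₁ (σ-range m' 1≤m' m'≤k)) (proj₂ (σ-range m' 1≤m' m'≤k)) σm<σm'
            (subst₂ _<_ (sym (τ∘σ m')) (sym (τ∘σ m)) m'<m))

  rowIncr⁺ : ∀ a b → 1 ≤ a → a ≤ k → 1 ≤ b → b ≤ k → R t b ≡ R t a → C t a < C t b → a < b
  rowIncr⁺ a b 1≤a a≤k 1≤b b≤k sameRow Ca<Cb = byGap (C t b ∸ suc (C t a)) b 1≤b b≤k sameRow
    (sym (trans (sym (+-suc _ (C t a))) (m∸n+n≡m Ca<Cb)))
    where
    byGap : ∀ gap b → 1 ≤ b → b ≤ k → R t b ≡ R t a → C t b ≡ suc gap + C t a → a < b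
    byGap zero b 1≤b b≤k sameRow nextCol = rowIncr a b 1≤a a≤k 1≤b b≤k sameRow nextCol
    byGap (suc gap) b 1≤b b≤k sameRow Cb≡ with inDiagram b 1≤b b≤k
    ... | 1≤Rb , _ , Cb≤len
      with surjective (R t b , suc gap + C t a)
             (1≤Rb , s≤s z≤n , ≤-trans (n≤1+n _) (subst (_≤ rowLen la (R t b)) Cb≡ Cb≤len))
    ... | e , 1≤e , e≤k , te≡ =
      <-trans (byGap gap e 1≤e e≤k (trans (cong proj₁ te≡) sameRow) (cong proj₂ te≡))
              (rowIncr e b 1≤e e≤k 1≤b b≤k (sym (cong proj₁ te≡)) (trans Cb≡ (cong suc (sym (cong proj₂ te≡)))))

  sameRow⇒C< : ∀ a b → 1 ≤ a → a ≤ k → 1 ≤ b → b ≤ k → R t b ≡ R t a → a < b → C t a < C t b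
  sameRow⇒C< a b 1≤a a≤k 1≤b b≤k sameRow a<b with <-cmp (C t a) (C t b)
  ... | tri< Ca<Cb _ _ = Ca<Cb
  ... | tri≈ _ Ca≡Cb _ = contradiction (injective a b 1≤a a≤k 1≤b b≤k (cong₂ _,_ (sym sameRow) Ca≡Cb)) (<⇒≢ a<b)
  ... | tri> _ _ Cb<Ca = contradiction (rowIncr⁺ b a 1≤b b≤k 1≤a a≤k (sym sameRow) Cb<Ca) (<-asym a<b)

module Varphi {la : List ℕ} {t : Tableau} {A P H : ℕ} (syt : IsSYT la H t)
  (1≤A : 1 ≤ A) (A≤P : A ≤ P) (P<H : P < H)
  (rowsIncrease : ∀ x y → A < x → x < y → y ≤ H → R t x < R t y)
  (R[1+P]≤R[A] : R t (suc P) ≤ R t A)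
  (R[A]<R : ∀ x → suc P < x → x ≤ H → R t A < R t x) where
  open IsSYT syt
  open Standard syt
  open IndexCycle A≤P P<H

  A<1+P : A < suc P
  A<1+P = s≤s A≤P

  ¬Adjacent-from-A : ∀ b → A < b → b ≤ P → ¬ Adjacent t A b
  ¬Adjacent-from-A b A<b b≤P adj with <-≤-trans (rowsIncrease b (suc P) A<b (s≤s b≤P) P<H) R[1+P]≤R[A] | adj
  ... | Rb<RA | inj₁ (sameRow , _) = <-irrefl sameRow Rb<RA
  ... | Rb<RA | inj₂ (_ , nextRow) = <⇒≱ Rb<RA (≤-trans (n≤1+n _) (≤-reflexive (sym nextRow)))

  -- If b sits directly below 1+P, then A and 1+P share a row; the entry e directly below A
  -- then lies left of b in b's row, and no position of e relative to 1+P is consistent.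
  ¬Adjacent-from-1+P : ∀ b → suc P < b → b ≤ H → ¬ Adjacent t (suc P) b
  ¬Adjacent-from-1+P b 1+P<b b≤H (inj₁ (sameRow , _)) = <-irrefl (sym sameRow) (rowsIncrease (suc P) b A<1+P 1+P<b b≤H)
  ¬Adjacent-from-1+P b 1+P<b b≤H (inj₂ (sameCol , nextRow)) = noPlaceBelowA entryBelowA
    where
    1≤b : 1 ≤ b
    1≤b = ≤-trans (s≤s z≤n) 1+P<b

    RA≡R[1+P] : R t A ≡ R t (suc P)
    RA≡R[1+P] = ≤-antisym (≤-pred (subst (R t A <_) nextRow (R[A]<R b 1+P<b b≤H))) R[1+P]≤R[A]

    CA<Cb : C t A < C t b
    CA<Cb = <-≤-trans (sameRow⇒C< A (suc P) 1≤A (<⇒≤ A<H) (s≤s z≤n) P<H (sym RA≡R[1+P]) A<1+P) (≤-reflexive (sym sameCol))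

    entryBelowA : ∃[ e ] (1 ≤ e × e ≤ H × t e ≡ (R t b , C t A))
    entryBelowA with inDiagram b 1≤b b≤H | inDiagram A 1≤A (<⇒≤ A<H)
    ... | 1≤Rb , _ , Cb≤len | _ , 1≤CA , _ = surjective _ (1≤Rb , 1≤CA , ≤-trans (<⇒≤ CA<Cb) Cb≤len)

    noPlaceBelowA : ¬ (∃[ e ] (1 ≤ e × e ≤ H × t e ≡ (R t b , C t A)))
    noPlaceBelowA (e , 1≤e , e≤H , te≡) with <-cmp e (suc P)
    ... | tri< e<1+P _ _ = <⇒≱ (rowsIncrease e (suc P) A<e e<1+P P<H) (≤-trans (≤-trans R[1+P]≤R[A] (n≤1+n _)) (≤-reflexive (sym Re)))
      where
      Re : R t e ≡ suc (R t A)
      Re = trans (cong proj₁ te≡) (trans nextRow (cong suc (sym RA≡R[1+P])))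
      A<e : A < e
      A<e = colIncr A e 1≤A (<⇒≤ A<H) 1≤e e≤H (cong proj₂ te≡) Re
    ... | tri≈ _ refl _ = <-irrefl (trans (cong proj₁ te≡) nextRow) (n<1+n _)
    ... | tri> _ _ 1+P<e = <-irrefl (cong proj₁ te≡) (rowsIncrease e b (<-trans A<1+P 1+P<e) e<b b≤H)
      where
      e<b : e < b
      e<b = rowIncr⁺ e b 1≤e e≤H 1≤b b≤H (sym (cong proj₁ te≡)) (subst (_< C t b) (sym (cong proj₂ te≡)) CA<Cb)

  noAdjacentInversion : ∀ a b → 1 ≤ a → a ≤ H → 1 ≤ b → b ≤ H → a < b → τ b < τ a → ¬ Adjacent t a b
  noAdjacentInversion a b _ a≤H _ b≤H a<b τb<τa adj with τ-case a
  ... | above H<a = <⇒≱ H<a a≤H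
  ... | below a<A rewrite τ-below a<A with b <? A
  ...   | yes b<A rewrite τ-below b<A = <-asym a<b τb<τa
  ...   | no b≮A = <⇒≱ (<-trans τb<τa a<A) (A≤τ (≮⇒≥ b≮A))
  noAdjacentInversion a b _ a≤H _ b≤H a<b τb<τa adj | at-A refl rewrite τ-A with τ-case b
  ... | below b<A = <-asym a<b b<A
  ... | at-A b≡A = <-irrefl (sym b≡A) a<b
  ... | at-1+P refl rewrite τ-1+P = <-asym τb<τa P<H
  ... | above H<b = <⇒≱ H<b b≤H
  noAdjacentInversion a (suc b) _ a≤H _ b≤H a<b τb<τa adj | at-A refl | between A<1+b 1+b≤H 1+b≢1+P
    rewrite τ-between A<1+b 1+b≤H 1+b≢1+P = ¬Adjacent-from-A (suc b) a<b τb<τa adj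
  noAdjacentInversion a b _ a≤H _ b≤H a<b τb<τa adj | at-1+P refl rewrite τ-1+P with τ-case b
  ... | below b<A = <-asym (<-trans A<1+P a<b) b<A
  ... | at-A refl = <-asym A<1+P a<b
  ... | at-1+P b≡1+P = <-irrefl (sym b≡1+P) a<b
  ... | between _ _ _ = ¬Adjacent-from-1+P b a<b b≤H adj
  ... | above H<b = <⇒≱ H<b b≤H
  noAdjacentInversion (suc a) b _ a≤H _ b≤H a<b τb<τa adj | between A<1+a 1+a≤H 1+a≢1+P
    rewrite τ-between A<1+a 1+a≤H 1+a≢1+P with τ-case b
  ... | below b<A = <-asym (<-trans A<1+a a<b) b<A
  ... | at-A refl = <-asym A<1+a a<b
  ... | at-1+P refl rewrite τ-1+P = <⇒≱ τb<τa (≤-trans (n≤1+n a) 1+a≤H)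
  ... | above H<b = <⇒≱ H<b b≤H
  noAdjacentInversion (suc a) (suc b) _ a≤H _ b≤H a<b τb<τa adj | between A<1+a 1+a≤H 1+a≢1+P | between A<1+b 1+b≤H 1+b≢1+P
    rewrite τ-between A<1+b 1+b≤H 1+b≢1+P = <-asym (≤-pred a<b) τb<τa

  module Image (U : Tableau) (U≡tσ : ∀ m → U m ≡ t (σ m)) where

    isSYT : IsSYT la H U
    isSYT = IsSYT-reindex σ τ (λ _ → σ-range 1≤A) (λ _ → τ-range 1≤A) τ∘σ≡id σ∘τ≡id noAdjacentInversion U U≡tσ

    R-U : ∀ m → R U m ≡ R t (σ m)
    R-U m = cong proj₁ (U≡tσ m)

    rowsIncrease-U : ∀ n → A ≤ n → suc n < H → R U n < R U (suc n)
    rowsIncrease-U n A≤n 1+n<H rewrite R-U n | R-U (suc n) with σ-case n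
    ... | below n<A = contradiction A≤n (<⇒≱ n<A)
    ... | at-H refl = contradiction 1+n<H (<-asym (n<1+n _))
    ... | above H<n = contradiction 1+n<H (<-asym (<-trans H<n (n<1+n _)))
    ... | at-P refl rewrite σ-P | σ-between (m≤n⇒m≤1+n A≤P) 1+n<H (≢-sym (<⇒≢ (n<1+n _))) =
          R[A]<R (suc (suc P)) (n<1+n _) 1+n<H
    ... | between A≤n n<H n≢P rewrite σ-between A≤n n<H n≢P with suc n ≟ P
    ...   | yes refl rewrite σ-P = <-≤-trans (rowsIncrease (suc n) (suc P) (s≤s A≤n) (n<1+n _) P<H) R[1+P]≤R[A]
    ...   | no 1+n≢P rewrite σ-between (m≤n⇒m≤1+n A≤n) 1+n<H 1+n≢P =
            rowsIncrease (suc n) (suc (suc n)) (s≤s A≤n) (n<1+n _) 1+n<H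

    lastStep-notIncreasing-U : ∀ H' → suc H' ≡ H → A ≤ H' → R U (suc H') ≤ R U H'
    lastStep-notIncreasing-U H' 1+H'≡H A≤H' rewrite R-U H' | R-U (suc H') | trans (cong σ 1+H'≡H) σ-H with H' ≟ P
    ... | yes refl rewrite σ-P = R[1+P]≤R[A]
    ... | no H'≢P rewrite σ-between A≤H' (subst (H' <_) 1+H'≡H (n<1+n _)) H'≢P =
          <⇒≤ (rowsIncrease (suc P) (suc H') A<1+P (s≤s (≤∧≢⇒< P≤H' (≢-sym H'≢P))) (≤-reflexive 1+H'≡H))
      where
      P≤H' : P ≤ H'
      P≤H' = ≤-pred (subst (P <_) (sym 1+H'≡H) P<H)

    R[H]≤R[P]-U : R U H ≤ R U P
    R[H]≤R[P]-U rewrite R-U H | R-U P | σ-H | σ-P = R[1+P]≤R[A]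

    R<R[H]-U : ∀ x → A ≤ x → x < P → R U x < R U H
    R<R[H]-U x A≤x x<P rewrite R-U x | R-U H | σ-H | σ-between A≤x (<-trans x<P P<H) (<⇒≢ x<P) =
      rowsIncrease (suc x) (suc P) (s≤s A≤x) (s≤s x<P) P<H

module Phi {la : List ℕ} (decreasing : Linked _≥_ la) {t : Tableau} {A P H : ℕ} (syt : IsSYT la H t)
  (1≤A : 1 ≤ A) (A≤P : A ≤ P) (P<H : P < H)
  (rowsIncrease : ∀ x y → A ≤ x → x < y → suc y ≤ H → R t x < R t y)
  (R[H]≤R[P] : R t H ≤ R t P)
  (R<R[H] : ∀ x → A ≤ x → x < P → R t x < R t H) where
  open IsSYT syt
  open Standard syt
  open IndexCycle A≤P P<H

  1≤H : 1 ≤ H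
  1≤H = ≤-trans 1≤A (<⇒≤ A<H)

  -- If P sits directly below a, then P = 1+a and P shares its row with H; the entry e directly
  -- above H then lies right of a in a's row, and no position of e relative to P is consistent.
  ¬Adjacent-to-P : ∀ a → A ≤ a → a < P → ¬ Adjacent t a P
  ¬Adjacent-to-P a A≤a a<P (inj₁ (sameRow , _)) = <-irrefl (sym sameRow) (rowsIncrease a P A≤a a<P P<H)
  ¬Adjacent-to-P a A≤a a<P (inj₂ (sameCol , nextRow)) with <-cmp (suc a) P
  ... | tri> _ _ P<1+a = <⇒≱ P<1+a a<P
  ... | tri< 1+a<P _ _ =
    <⇒≱ (≤-<-trans (rowsIncrease a (suc a) A≤a (n<1+n a) (<-trans 1+a<P P<H))
                   (rowsIncrease (suc a) P (m≤n⇒m≤1+n A≤a) 1+a<P P<H))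
        (≤-reflexive nextRow)
  ... | tri≈ _ 1+a≡P _ = noPlaceAboveH entryAboveH
    where
    1≤a : 1 ≤ a
    1≤a = ≤-trans 1≤A A≤a

    a≤H : a ≤ H
    a≤H = <⇒≤ (<-trans a<P P<H)

    RH≡RP : R t H ≡ R t P
    RH≡RP = ≤-antisym R[H]≤R[P] (subst (_≤ R t H) (sym nextRow) (R<R[H] a A≤a a<P))

    CP<CH : C t P < C t H
    CP<CH = sameRow⇒C< P H (≤-trans 1≤A A≤P) (<⇒≤ P<H) 1≤H ≤-refl RH≡RP P<H

    entryAboveH : ∃[ e ] (1 ≤ e × e ≤ H × t e ≡ (R t a , C t H))
    entryAboveH with inDiagram a 1≤a a≤H | inDiagram H 1≤H ≤-refl
    ... | 1≤Ra , _ , _ | _ , 1≤CH , CH≤len =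
      surjective _ (1≤Ra , 1≤CH , ≤-trans (subst (λ r → C t H ≤ rowLen la r) (trans RH≡RP nextRow) CH≤len)
                                           (rowLen-antitone decreasing 1≤Ra))

    noPlaceAboveH : ¬ (∃[ e ] (1 ≤ e × e ≤ H × t e ≡ (R t a , C t H)))
    noPlaceAboveH (e , 1≤e , e≤H , te≡) with <-cmp e P
    ... | tri< e<P _ _ = <⇒≱ a<e (≤-pred (subst (e <_) (sym 1+a≡P) e<P))
      where
      a<e : a < e
      a<e = rowIncr⁺ a e 1≤a a≤H 1≤e e≤H (cong proj₁ te≡) (subst₂ _<_ sameCol (sym (cong proj₂ te≡)) CP<CH)
    ... | tri≈ _ refl _ = <-irrefl (trans (sym (cong proj₁ te≡)) nextRow) (n<1+n _)
    ... | tri> _ _ P<e =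
      <-asym (subst (R t P <_) (cong proj₁ te≡) (rowsIncrease P e A≤P P<e e<H)) (subst (R t a <_) (sym nextRow) (n<1+n _))
      where
      e<H : e < H
      e<H = colIncr e H 1≤e e≤H 1≤H ≤-refl (sym (cong proj₂ te≡)) (trans RH≡RP (trans nextRow (cong suc (sym (cong proj₁ te≡)))))

  ¬Adjacent-to-H : ∀ a → P < a → a < H → ¬ Adjacent t a H
  ¬Adjacent-to-H a P<a a<H adj with ≤-<-trans R[H]≤R[P] (rowsIncrease P a A≤P P<a a<H) | adj
  ... | RH<Ra | inj₁ (sameRow , _) = <-irrefl sameRow RH<Ra
  ... | RH<Ra | inj₂ (_ , nextRow) = <⇒≱ RH<Ra (≤-trans (n≤1+n _) (≤-reflexive (sym nextRow)))

  noAdjacentInversion : ∀ a b → 1 ≤ a → a ≤ H → 1 ≤ b → b ≤ H → a < b → σ b < σ a → ¬ Adjacent t a b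
  noAdjacentInversion a b _ a≤H _ b≤H a<b σb<σa adj with σ-case a
  ... | at-P refl rewrite σ-P = <⇒≱ σb<σa (A≤σ (≤-trans A≤P (<⇒≤ a<b)))
  ... | at-H refl = <⇒≱ a<b b≤H
  ... | above H<a = <⇒≱ H<a a≤H
  ... | below a<A rewrite σ-below a<A with b <? A
  ...   | yes b<A rewrite σ-below b<A = <-asym a<b σb<σa
  ...   | no b≮A = <⇒≱ (<-trans σb<σa a<A) (A≤σ (≮⇒≥ b≮A))
  noAdjacentInversion a b _ a≤H _ b≤H a<b σb<σa adj | between A≤a a<H a≢P rewrite σ-between A≤a a<H a≢P with σ-case b
  ... | below b<A = <-asym (≤-<-trans A≤a a<b) b<A
  ... | at-P refl = ¬Adjacent-to-P a A≤a a<b adj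
  ... | at-H refl rewrite σ-H = ¬Adjacent-to-H a (≤-pred σb<σa) a<H adj
  ... | between A≤b b<H b≢P rewrite σ-between A≤b b<H b≢P = <-asym a<b (≤-pred σb<σa)
  ... | above H<b = <⇒≱ H<b b≤H

  module Image (U : Tableau) (U≡tτ : ∀ m → U m ≡ t (τ m)) where

    isSYT : IsSYT la H U
    isSYT = IsSYT-reindex τ σ (λ _ → τ-range 1≤A) (λ _ → σ-range 1≤A) σ∘τ≡id τ∘σ≡id noAdjacentInversion U U≡tτ

    R-U : ∀ m → R U m ≡ R t (τ m)
    R-U m = cong proj₁ (U≡tτ m)

    rowsIncrease-U : ∀ n → A < n → suc n ≤ H → R U n < R U (suc n)
    rowsIncrease-U n A<n 1+n≤H rewrite R-U n | R-U (suc n) with τ-case n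
    ... | below n<A = contradiction A<n (<-asym n<A)
    ... | at-A refl = contradiction A<n (<-irrefl refl)
    ... | above H<n = contradiction (≤-trans (n≤1+n n) 1+n≤H) (<⇒≱ H<n)
    ... | at-1+P refl rewrite τ-1+P | τ-between (<-trans A<n (n<1+n n)) 1+n≤H (≢-sym (<⇒≢ (n<1+n _))) =
          ≤-<-trans R[H]≤R[P] (rowsIncrease P (suc P) A≤P (n<1+n P) 1+n≤H)
    rowsIncrease-U (suc n) A<1+n 1+n≤H | between _ n≤H 1+n≢1+P rewrite τ-between A<1+n n≤H 1+n≢1+P with suc n ≟ P
    ...   | yes refl rewrite τ-1+P = R<R[H] n (≤-pred A<1+n) (n<1+n n)
    ...   | no 1+n≢P rewrite τ-between (<-trans A<1+n (n<1+n _)) 1+n≤H (1+n≢P ∘ suc-injective) =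
            rowsIncrease n (suc n) (≤-pred A<1+n) (n<1+n n) 1+n≤H

    firstStep-notIncreasing-U : R U (suc A) ≤ R U A
    firstStep-notIncreasing-U rewrite R-U A | R-U (suc A) | τ-A with A ≟ P
    ... | yes refl rewrite τ-1+P = R[H]≤R[P]
    ... | no A≢P rewrite τ-between (n<1+n A) (≤-<-trans A≤P P<H) (A≢P ∘ suc-injective) =
          <⇒≤ (rowsIncrease A P ≤-refl (≤∧≢⇒< A≤P A≢P) P<H)

    R[1+P]≤R[A]-U : R U (suc P) ≤ R U A
    R[1+P]≤R[A]-U rewrite R-U A | R-U (suc P) | τ-A | τ-1+P = R[H]≤R[P]

    R[A]<R-U : ∀ x → suc P < x → x ≤ H → R U A < R U x
    R[A]<R-U (suc x) 1+P<1+x 1+x≤H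
      rewrite R-U A | R-U (suc x) | τ-A | τ-between (s≤s (≤-trans A≤P (≤-pred (<⇒≤ 1+P<1+x)))) 1+x≤H (≢-sym (<⇒≢ 1+P<1+x)) =
      rowsIncrease P x A≤P (≤-pred 1+P<1+x) 1+x≤H

interval-offset : ∀ {Q : ℕ → Set} α {lo hi} → (∀ i → lo ≤ i → i < hi → Q (i + α)) →
  ∀ x → lo + α ≤ x → x < hi + α → Q x
interval-offset {Q} α {lo} {hi} onInterval x lo+α≤x x<hi+α =
  subst Q x∸α+α≡x (onInterval (x ∸ α)
    (+-cancelʳ-≤ α lo (x ∸ α) (subst (lo + α ≤_) (sym x∸α+α≡x) lo+α≤x))
    (+-cancelʳ-< α (x ∸ α) hi (subst (_< hi + α) (sym x∸α+α≡x) x<hi+α)))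
  where
  x∸α+α≡x : x ∸ α + α ≡ x
  x∸α+α≡x = m∸n+n≡m (≤-trans (m≤n+m α lo) lo+α≤x)

module _ (h a : ℕ) (la : List ℕ) (T : Tableau) where
  private
    α H : ℕ
    α = suc a
    H = suc h + α

  varphi-unfold : ∀ p → ¬ RowCond (suc h) a T → IsMaxOf (λ i → R T (i + α) ≤ R T α) 1 (suc h) (suc p) →
    varphi la (suc h) α T ≡ varphiCore (suc h) α (suc p) T
  varphi-unfold p ¬rc (1≤q , q≤h , Pq , above)
    rewrite ¬T⇒≡false (¬rc ∘ rowCondᵇ-sound (suc h) a T)
          | maxSat-unique _ (suc h) (1≤q , q≤h , ≤⇒≤ᵇ Pq , λ i q<i i≤h → above i q<i i≤h ∘ ≤ᵇ⇒≤ _ _) = refl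

  phi-unfold : ∀ p → ¬ RowCond (suc h) α T → IsMinOf (λ i → R T H ≤ R T (i + α)) 0 h p →
    phi la (suc h) α T ≡ phiCore (suc h) α p T
  phi-unfold p ¬rc (_ , p≤h , Pp , below)
    rewrite ¬T⇒≡false (¬rc ∘ rowCondᵇ-sound (suc h) α T)
          | minSatFrom-unique _ (suc h) z≤n (s≤s p≤h) (≤⇒≤ᵇ Pp) (λ i 0≤i i<p → below i 0≤i i<p ∘ ≤ᵇ⇒≤ _ _) = refl

  varphi-image : SYTh la H (suc h) α T → ¬ SYTh la H (suc h) a T →
    ∀ q → IsMaxOf (λ i → R T (i + α) ≤ R T α) 1 (suc h) q →
      SYTh la H (suc h) a (varphi la (suc h) α T)
      × ¬ SYTh la H (suc h) α (varphi la (suc h) α T)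
      × IsMinOf (λ i → R (varphi la (suc h) α T) H ≤ R (varphi la (suc h) α T) (i + α)) 0 h (q ∸ 1)
  varphi-image (syt , rc) ¬syt' (suc p) isMax@(_ , 1+p≤1+h , Pq , above)
    rewrite varphi-unfold p (λ rc' → ¬syt' (syt , rc')) isMax = (isSYT , rowCond) , notRowCond , isMin
    where
    open Varphi syt (s≤s z≤n) (m≤n+m α p) (+-monoˡ-≤ α 1+p≤1+h) (λ x y → RowCond⇒R-increasing T rc) Pq
      (λ x 1+P<x x≤H → interval-offset {λ x → R T α < R T x} α (λ i 1+q≤i i<1+h → ≰⇒> (above i 1+q≤i (≤-pred i<1+h))) x 1+P<x (s≤s x≤H))
    open Image (varphiCore (suc h) α (suc p) T) (varphiCore≡varphiIndex (suc h) α p T)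

    ¬rc : ¬ RowCond (suc h) a T
    ¬rc rc' = ¬syt' (syt , rc')

    rowCond : RowCond (suc h) a (varphiCore (suc h) α (suc p) T)
    rowCond i 1≤i i<1+h = rowsIncrease-U (i + a) (+-monoˡ-≤ a 1≤i) (≤-<-trans (+-monoˡ-≤ a i<1+h) (+-monoʳ-< (suc h) (n<1+n a)))

    notRowCond : ¬ SYTh la H (suc h) α (varphiCore (suc h) α (suc p) T)
    notRowCond (_ , rc') = <⇒≱ (rc' h 1≤h (n<1+n h)) (lastStep-notIncreasing-U (h + α) refl (m≤n+m α h))
      where
      1≤h : 1 ≤ h
      1≤h = ≤-pred (¬RowCond⇒2≤h T ¬rc)

    isMin : IsMinOf (λ i → R (varphiCore (suc h) α (suc p) T) H ≤ R (varphiCore (suc h) α (suc p) T) (i + α)) 0 h p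
    isMin = z≤n , ≤-pred 1+p≤1+h , R[H]≤R[P]-U ,
            λ i _ i<p → <⇒≱ (R<R[H]-U (i + α) (m≤n+m α i) (+-monoˡ-< α i<p))

  phi-image : Linked _≥_ la → SYTh la H (suc h) a T → ¬ SYTh la H (suc h) α T →
    ∀ p → IsMinOf (λ i → R T H ≤ R T (i + α)) 0 h p →
      SYTh la H (suc h) α (phi la (suc h) α T)
      × ¬ SYTh la H (suc h) a (phi la (suc h) α T)
      × IsMaxOf (λ i → R (phi la (suc h) α T) (i + α) ≤ R (phi la (suc h) α T) α) 1 (suc h) (p + 1)
  phi-image decreasing (syt , rc) ¬syt' p isMin@(_ , p≤h , Pp , below)
    rewrite phi-unfold p (λ rc' → ¬syt' (syt , rc')) isMin = (isSYT , rowCond) , notRowCond , isMax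
    where
    open Phi decreasing syt (s≤s z≤n) (m≤n+m α p) (+-monoˡ-< α (s≤s p≤h))
      (λ x y α≤x x<y 1+y≤H → RowCond⇒R-increasing T rc α≤x x<y (≤-pred (subst (suc y ≤_) (+-suc (suc h) a) 1+y≤H)))
      Pp
      (interval-offset {λ x → R T x < R T H} α {0} (λ i _ i<p → ≰⇒> (below i z≤n i<p)))
    open Image (phiCore (suc h) α p T) (phiCore≡phiIndex (suc h) α p T)

    rowCond : RowCond (suc h) α (phiCore (suc h) α p T)
    rowCond i 1≤i i<1+h = rowsIncrease-U (i + α) (+-monoˡ-≤ α 1≤i) (+-monoˡ-≤ α i<1+h)

    notRowCond : ¬ SYTh la H (suc h) a (phiCore (suc h) α p T)
    notRowCond (_ , rc') = <⇒≱ (rc' 1 ≤-refl (¬RowCond⇒2≤h T (λ rc'' → ¬syt' (syt , rc'')))) firstStep-notIncreasing-U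

    isMax : IsMaxOf (λ i → R (phiCore (suc h) α p T) (i + α) ≤ R (phiCore (suc h) α p T) α) 1 (suc h) (p + 1)
    isMax = subst (IsMaxOf _ 1 (suc h)) (+-comm 1 p)
      (s≤s z≤n , s≤s p≤h , R[1+P]≤R[A]-U ,
       λ i 1+p<i i≤1+h → <⇒≱ (R[A]<R-U (i + α) (+-monoˡ-< α 1+p<i) (+-monoˡ-≤ α i≤1+h)))

lemma4p6 : (h α : ℕ) (la : List ℕ) → 0 < h → 0 < α → IsPartitionOf la (h + α) →
    ((T : Tableau) → SYTh la (h + α) h α T → ¬ SYTh la (h + α) h (α ∸ 1) T →
      (q : ℕ) → IsMaxOf (λ i → R T (i + α) ≤ R T α) 1 h q →
        SYTh la (h + α) h (α ∸ 1) (varphi la h α T)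
        × ¬ SYTh la (h + α) h α (varphi la h α T)
        × IsMinOf (λ i → R (varphi la h α T) (h + α) ≤ R (varphi la h α T) (i + α)) 0 (h ∸ 1) (q ∸ 1))
    × ((T : Tableau) → SYTh la (h + α) h (α ∸ 1) T → ¬ SYTh la (h + α) h α T →
      (p : ℕ) → IsMinOf (λ i → R T (h + α) ≤ R T (i + α)) 0 (h ∸ 1) p →
        SYTh la (h + α) h α (phi la h α T)
        × ¬ SYTh la (h + α) h (α ∸ 1) (phi la h α T)
        × IsMaxOf (λ i → R (phi la h α T) (i + α) ≤ R (phi la h α T) α) 1 h (p + 1))
lemma4p6 (suc h) (suc a) la _ _ (decreasing , _) =
  (λ T → varphi-image h a la T) , (λ T → phi-image h a la T decreasing)
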